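{- Let $S$ be a pairwise single-meeting storyline whose event graph $G$ has $n$ vertices, $m\ge 1$ edges and maximum degree $\Delta$, and let $L^{*}$ be the total edge length of an optimal linear ordering of $G$. Then every storyline visualization of $S$ has $\Omega\!\left(\frac{L^{*}-m}{2\Delta}\right)$ crossings.
   Context: A storyline $S=(C,\mathcal{T},\mathcal{E})$ consists of a set of characters $C=\{1,\dots,n\}$, a set $\mathcal{T}$ of closed time intervals $[s,t]$ with $s,t\in\mathbb{N}$, $s\le t$, and a set of events $\mathcal{E}\subseteq 2^C\times\mathcal{T}$; an event $E_i=(C_i,[s_i,t_i])$ means the characters in $C_i$ meet during the whole interval $[s_i,t_i]$, and no character participates in two events with overlapping time intervals. A storyline visualization is a drawing in the plane in which the $x$-axis represents time and each character is drawn as an $x$-monotone curve, so that at each time the curves appear in some vertical order; during each event $(C_i,[s_i,t_i])$ the curves of the characters in $C_i$ are grouped within a small vertical distance $\delta_{\mathrm{group}}$ of one another (in particular they are consecutive in the vertical order), while otherwise curves are separated by a larger vertical distance $\delta_{\mathrm{separate}}>\delta_{\mathrm{group}}$. The number of crossings of a visualization is the total number of crossing points between pairs of character curves. A storyline is pairwise single-meeting if every event involves exactly two characters and every pair of characters meets in at most one event. Its event graph is the graph with vertex set $C$ having an edge $\{u,v\}$ for each event $(\{u,v\},[s,t])$. An optimal linear ordering of a graph $G=(V,E)$ with $|V|=n$ is a bijection $\pi:V\to\{1,\dots,n\}$ minimizing $\sum_{\{u,v\}\in E}|\pi(u)-\pi(v)|$; $L^{*}$ denotes this minimum value. -}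

module Defs where

open import Data.Nat using (ℕ; zero; suc; _+_; _*_; _∸_; _≤_; _<_; _⊔_; ∣_-_∣)
open import Data.Fin using (Fin; toℕ) renaming (_≟_ to _≟ᶠ_)
open import Data.Fin.Permutation using (Permutation′; _⟨$⟩ʳ_)
open import Data.List using (List; length; map; filter; foldr; allFin; lookup)
open import Data.Nat.ListAction using (sum)
open import Data.List.Relation.Unary.All using (All)
open import Data.Product using (_×_; _,_)
open import Data.Sum using (_⊎_)
open import Relation.Binary.PropositionalEquality using (_≡_; _≢_)
open import Relation.Nullary using (¬_; Dec; yes; no)
open import Relation.Nullary.Decidable using (_⊎-dec_; _×-dec_)
open import Data.Nat.Properties using (_<?_)

-- Characters are Fin n.  A two-character event ({u,v},[s,t]).
record Event (n : ℕ) : Set where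
  constructor event
  field
    u v : Fin n
    s t : ℕ
open Event public

_∈ₑ_ : ∀ {n} → Fin n → Event n → Set
c ∈ₑ e = (c ≡ u e) ⊎ (c ≡ v e)

_∈ₑ?_ : ∀ {n} (c : Fin n) (e : Event n) → Dec (c ∈ₑ e)
c ∈ₑ? e = (c ≟ᶠ u e) ⊎-dec (c ≟ᶠ v e)

ValidStoryline : ∀ {n} → List (Event n) → Set
ValidStoryline {n} es =
  All (λ e → (u e ≢ v e) × (s e ≤ t e)) es ×
  (∀ (i j : Fin (length es)) → i ≢ j → (c : Fin n) →
     c ∈ₑ lookup es i → c ∈ₑ lookup es j →
     (t (lookup es i) < s (lookup es j)) ⊎ (t (lookup es j) < s (lookup es i)))

SamePair : ∀ {n} → Event n → Event n → Set
SamePair e f = ((u e ≡ u f) × (v e ≡ v f)) ⊎ ((u e ≡ v f) × (v e ≡ u f))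

PairwiseSingleMeeting : ∀ {n} → List (Event n) → Set
PairwiseSingleMeeting es =
  ∀ (i j : Fin (length es)) → i ≢ j → ¬ SamePair (lookup es i) (lookup es j)

-- Event graph: vertices Fin n, one edge {u,v} per event.
-- (Under pairwise single-meeting, m = length es is its number of edges.)
degree : ∀ {n} → List (Event n) → Fin n → ℕ
degree es c = length (filter (c ∈ₑ?_) es)

maxDegree : ∀ {n} → List (Event n) → ℕ
maxDegree {n} es = foldr _⊔_ 0 (map (degree es) (allFin n))

-- Linear ordering = bijection V → positions (Fin n); total edge length.
orderingCost : ∀ {n} → List (Event n) → Permutation′ n → ℕ
orderingCost es π =
  sum (map (λ e → ∣ toℕ (π ⟨$⟩ʳ u e) - toℕ (π ⟨$⟩ʳ v e) ∣) es)

OptimalOrdering : ∀ {n} → List (Event n) → Permutation′ n → Set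
OptimalOrdering {n} es π = ∀ (σ : Permutation′ n) → orderingCost es π ≤ orderingCost es σ

-- Number of pairs of characters whose relative vertical order differs
-- between two vertical orders p and q (p maps a character to its position).
-- This is the minimum number of crossings needed to go from p to q.
swapped : ∀ {n} → Permutation′ n → Permutation′ n → Fin n → Fin n → Set
swapped p q a b =
  (toℕ (p ⟨$⟩ʳ a) < toℕ (p ⟨$⟩ʳ b)) × (toℕ (q ⟨$⟩ʳ b) < toℕ (q ⟨$⟩ʳ a))

swapped? : ∀ {n} (p q : Permutation′ n) (a b : Fin n) → Dec (swapped p q a b)
swapped? p q a b = (toℕ (p ⟨$⟩ʳ a) <? toℕ (p ⟨$⟩ʳ b)) ×-dec (toℕ (q ⟨$⟩ʳ b) <? toℕ (q ⟨$⟩ʳ a))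

inversions : ∀ {n} → Permutation′ n → Permutation′ n → ℕ
inversions {n} p q =
  sum (map (λ a → length (filter (swapped? p q a) (allFin n))) (allFin n))

-- Combinatorial storyline visualization: the vertical order of the curves
-- at every integer time (order τ maps a character to its vertical position),
-- up to a horizon T after all events have ended; during every event the two
-- characters' curves are consecutive in the vertical order.
record Visualization {n : ℕ} (es : List (Event n)) : Set where
  field
    horizon   : ℕ
    order     : ℕ → Permutation′ n
    afterAll  : All (λ e → t e ≤ horizon) es
    grouped   : All (λ e → ∀ τ → s e ≤ τ → τ ≤ t e →
                   ∣ toℕ (order τ ⟨$⟩ʳ u e) - toℕ (order τ ⟨$⟩ʳ v e) ∣ ≡ 1) es
open Visualization public

crossingsUpTo : ∀ {n} → (ℕ → Permutation′ n) → ℕ → ℕ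
crossingsUpTo ord zero = 0
crossingsUpTo ord (suc T) = crossingsUpTo ord T + inversions (ord T) (ord (suc T))

crossings : ∀ {n} {es : List (Event n)} → Visualization es → ℕ
crossings V = crossingsUpTo (order V) (horizon V)

-- The vertical order at time 0 is itself a linear ordering of the event graph, so L* is at
-- most its total edge length.  A curve that moves d positions between two times must cross at
-- least d other curves, and the two curves of an event are adjacent while it takes place; hence
-- every edge {u,v} has length at most 1 + c(u) + c(v) in the initial order, where c(a) counts the
-- crossings on the curve of a.  Summing over the m edges counts each c(a) deg(a) ≤ Δ times, and
-- the c(a) add up to twice the number of crossings, so L* − m ≤ 2Δ · crossings.
module Submission where

open import Defs
open import Data.Nat using (ℕ; _*_; _∸_; _≤_)
open import Data.List using (List; length)
open import Data.Product using (∃-syntax)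
open import Data.Fin.Permutation using (Permutation′)

open import Data.Nat using (zero; suc; _+_; _<_; _⊔_; ∣_-_∣; z≤n; s≤s; s≤s⁻¹; _≤′_; ≤′-refl; ≤′-step)
open import Data.Nat.Properties
open import Data.Nat.ListAction using (sum)
open import Data.Fin as Fin using (Fin; toℕ)
open import Data.Fin.Properties using (toℕ-injective; toℕ<n)
open import Data.Fin.Permutation using (_⟨$⟩ʳ_; _⟨$⟩ˡ_; inverseˡ)
open import Data.List using ([]; _∷_; map; filter; allFin; tabulate; foldr)
open import Data.List.Properties using (map-tabulate)
open import Data.List.Relation.Unary.All as All using (All; []; _∷_)
open import Data.Product using (_×_; _,_; proj₁)
open import Data.Sum using (_⊎_; inj₁; inj₂; [_,_])
open import Relation.Nullary using (¬_; Dec; yes; no; contradiction)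
open import Relation.Nullary.Decidable using (_⊎-dec_)
open import Relation.Binary.PropositionalEquality using (_≡_; _≢_; refl; sym; trans; cong; cong₂; subst; subst₂; module ≡-Reasoning)
open import Function using (_∘_; id)
open import Algebra.Properties.CommutativeSemigroup +-commutativeSemigroup using (x∙yz≈y∙xz)
open import Algebra.Properties.Semiring.Sum +-*-semiring
  using (sum-syntax; sum-cong-≗; sum-replicate-zero; ∑-distrib-+; ∑-comm; ∑-permute; *-distribˡ-sum)
  renaming (sum to ∑)

𝟙 : ∀ {p} {P : Set p} → Dec P → ℕ
𝟙 (yes _) = 1
𝟙 (no _)  = 0

𝟙-yes : ∀ {P : Set} → P → (p : Dec P) → 𝟙 p ≡ 1
𝟙-yes x (yes _) = refl
𝟙-yes x (no ¬x) = contradiction x ¬x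

𝟙-cong : ∀ {P Q : Set} → (P → Q) → (Q → P) → (p : Dec P) (q : Dec Q) → 𝟙 p ≡ 𝟙 q
𝟙-cong f g (yes _) (yes _) = refl
𝟙-cong f g (yes x) (no ¬y) = contradiction (f x) ¬y
𝟙-cong f g (no ¬x) (yes y) = contradiction (g y) ¬x
𝟙-cong f g (no _)  (no _)  = refl

𝟙-≤-⊎ : ∀ {P Q R : Set} → (P → Q ⊎ R) → (p : Dec P) (q : Dec Q) (r : Dec R) → 𝟙 p ≤ 𝟙 q + 𝟙 r
𝟙-≤-⊎ f (no _)  q       r       = z≤n
𝟙-≤-⊎ f (yes _) (yes _) r       = s≤s z≤n
𝟙-≤-⊎ f (yes _) (no _)  (yes _) = s≤s z≤n
𝟙-≤-⊎ f (yes x) (no ¬q) (no ¬r) = contradiction (f x) [ ¬q , ¬r ]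

length-filter≡sum-𝟙 : ∀ {A : Set} {P : A → Set} (P? : ∀ x → Dec (P x)) (xs : List A) →
                      length (filter P? xs) ≡ sum (map (𝟙 ∘ P?) xs)
length-filter≡sum-𝟙 P? []       = refl
length-filter≡sum-𝟙 P? (x ∷ xs) with P? x
... | yes _ = cong suc (length-filter≡sum-𝟙 P? xs)
... | no _  = length-filter≡sum-𝟙 P? xs

sum-map-allFin : ∀ {n} (f : Fin n → ℕ) → sum (map f (allFin n)) ≡ ∑[ i < n ] f i
sum-map-allFin f = trans (cong sum (map-tabulate id f)) (sum-tabulate f)
  where
  sum-tabulate : ∀ {n} (f : Fin n → ℕ) → sum (tabulate f) ≡ ∑[ i < n ] f i
  sum-tabulate {zero}  f = refl
  sum-tabulate {suc n} f = cong (f Fin.zero +_) (sum-tabulate (f ∘ Fin.suc))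

∑-mono-≤ : ∀ {n} {f g : Fin n → ℕ} → (∀ i → f i ≤ g i) → ∑ f ≤ ∑ g
∑-mono-≤ {zero}  f≤g = z≤n
∑-mono-≤ {suc n} f≤g = +-mono-≤ (f≤g Fin.zero) (∑-mono-≤ (f≤g ∘ Fin.suc))

∑-≥-term : ∀ {n} (f : Fin n → ℕ) i → f i ≤ ∑ f
∑-≥-term f Fin.zero    = m≤m+n _ _
∑-≥-term f (Fin.suc i) = ≤-trans (∑-≥-term (f ∘ Fin.suc) i) (m≤n+m _ _)

∑-≥-pair : ∀ {n} (f : Fin n → ℕ) i j → i ≢ j → f i + f j ≤ ∑ f
∑-≥-pair f Fin.zero    Fin.zero    i≢j = contradiction refl i≢j
∑-≥-pair f Fin.zero    (Fin.suc j) i≢j = +-monoʳ-≤ (f Fin.zero) (∑-≥-term (f ∘ Fin.suc) j)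
∑-≥-pair f (Fin.suc i) Fin.zero    i≢j =
  subst (_≤ ∑ f) (+-comm (f Fin.zero) _) (+-monoʳ-≤ (f Fin.zero) (∑-≥-term (f ∘ Fin.suc) i))
∑-≥-pair f (Fin.suc i) (Fin.suc j) i≢j =
  ≤-trans (∑-≥-pair (f ∘ Fin.suc) i j (i≢j ∘ cong Fin.suc)) (m≤n+m _ _)

∣m+n-o+p∣≤∣m-o∣+∣n-p∣ : ∀ m n o p → ∣ m + n - o + p ∣ ≤ ∣ m - o ∣ + ∣ n - p ∣
∣m+n-o+p∣≤∣m-o∣+∣n-p∣ m n o p = begin
  ∣ m + n - o + p ∣                     ≤⟨ ∣-∣-triangle (m + n) (o + n) (o + p) ⟩
  ∣ m + n - o + n ∣ + ∣ o + n - o + p ∣ ≡⟨ cong₂ (λ x y → ∣ x - y ∣ + ∣ o + n - o + p ∣) (+-comm m n) (+-comm o n) ⟩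
  ∣ n + m - n + o ∣ + ∣ o + n - o + p ∣ ≡⟨ cong₂ _+_ (∣m+n-m+o∣≡∣n-o∣ n m o) (∣m+n-m+o∣≡∣n-o∣ o n p) ⟩
  ∣ m - o ∣ + ∣ n - p ∣                 ∎
  where open ≤-Reasoning

∣∑-∑∣≤∑∣-∣ : ∀ {n} (f g : Fin n → ℕ) → ∣ ∑ f - ∑ g ∣ ≤ ∑[ i < n ] ∣ f i - g i ∣
∣∑-∑∣≤∑∣-∣ {zero}  f g = z≤n
∣∑-∑∣≤∑∣-∣ {suc n} f g =
  ≤-trans (∣m+n-o+p∣≤∣m-o∣+∣n-p∣ (f Fin.zero) _ (g Fin.zero) _)
          (+-monoʳ-≤ _ (∣∑-∑∣≤∑∣-∣ (f ∘ Fin.suc) (g ∘ Fin.suc)))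

∑-𝟙-toℕ< : ∀ {n} k → k ≤ n → ∑[ i < n ] 𝟙 (toℕ i <? k) ≡ k
∑-𝟙-toℕ< {zero}  zero    z≤n = refl
∑-𝟙-toℕ< {suc n} zero    _   =
  trans (sum-cong-≗ {n} (λ i → 𝟙-cong (λ ()) (λ ()) (toℕ (Fin.suc i) <? 0) (toℕ i <? 0)))
        (∑-𝟙-toℕ< {n} zero z≤n)
∑-𝟙-toℕ< {suc n} (suc k) k<n =
  cong suc (trans (sum-cong-≗ {n} (λ i → 𝟙-cong s≤s⁻¹ s≤s (toℕ (Fin.suc i) <? suc k) (toℕ i <? k)))
                  (∑-𝟙-toℕ< k (s≤s⁻¹ k<n)))

pos : ∀ {n} → Permutation′ n → Fin n → ℕ
pos p a = toℕ (p ⟨$⟩ʳ a)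

pos-injective : ∀ {n} (p : Permutation′ n) {a b} → pos p a ≡ pos p b → a ≡ b
pos-injective p {a} {b} eq = begin
  a                         ≡⟨ inverseˡ p ⟨
  p ⟨$⟩ˡ (p ⟨$⟩ʳ a)         ≡⟨ cong (p ⟨$⟩ˡ_) (toℕ-injective eq) ⟩
  p ⟨$⟩ˡ (p ⟨$⟩ʳ b)         ≡⟨ inverseˡ p ⟩
  b                         ∎
  where open ≡-Reasoning

pos≡∑-𝟙-below : ∀ {n} (p : Permutation′ n) a → pos p a ≡ ∑[ b < n ] 𝟙 (pos p b <? pos p a)
pos≡∑-𝟙-below p a = trans (sym (∑-𝟙-toℕ< (pos p a) (<⇒≤ (toℕ<n (p ⟨$⟩ʳ a)))))
                          (∑-permute (λ i → 𝟙 (toℕ i <? pos p a)) p)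

Discordant : ∀ {n} → Permutation′ n → Permutation′ n → Fin n → Fin n → Set
Discordant p q a b = swapped p q a b ⊎ swapped p q b a

discordant? : ∀ {n} (p q : Permutation′ n) a b → Dec (Discordant p q a b)
discordant? p q a b = swapped? p q a b ⊎-dec swapped? p q b a

discordances : ∀ {n} → Permutation′ n → Permutation′ n → Fin n → ℕ
discordances {n} p q a = ∑[ b < n ] 𝟙 (discordant? p q a b)

pos-<-of-≮ : ∀ {n} (p : Permutation′ n) {a b} → a ≢ b → ¬ pos p b < pos p a → pos p a < pos p b
pos-<-of-≮ p a≢b b≮a = ≤∧≢⇒< (≮⇒≥ b≮a) (a≢b ∘ pos-injective p)

∣𝟙-𝟙∣≤𝟙 : ∀ {P Q R : Set} → (P → ¬ Q → R) → (¬ P → Q → R) →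
           (p : Dec P) (q : Dec Q) (r : Dec R) → ∣ 𝟙 p - 𝟙 q ∣ ≤ 𝟙 r
∣𝟙-𝟙∣≤𝟙 f g (yes _) (yes _) r = z≤n
∣𝟙-𝟙∣≤𝟙 f g (no _)  (no _)  r = z≤n
∣𝟙-𝟙∣≤𝟙 f g (yes x) (no ¬y) r = ≤-reflexive (sym (𝟙-yes (f x ¬y) r))
∣𝟙-𝟙∣≤𝟙 f g (no ¬x) (yes y) r = ≤-reflexive (sym (𝟙-yes (g ¬x y) r))

∣𝟙-below-𝟙-below∣≤𝟙-discordant : ∀ {n} (p q : Permutation′ n) a b →
  ∣ 𝟙 (pos p b <? pos p a) - 𝟙 (pos q b <? pos q a) ∣ ≤ 𝟙 (discordant? p q a b)
∣𝟙-below-𝟙-below∣≤𝟙-discordant p q a b =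
  ∣𝟙-𝟙∣≤𝟙 (λ pb<pa qb≮qa → inj₂ (pb<pa , pos-<-of-≮ q (distinct p pb<pa) qb≮qa))
          (λ pb≮pa qb<qa → inj₁ (pos-<-of-≮ p (distinct q qb<qa) pb≮pa , qb<qa))
          (pos p b <? pos p a) (pos q b <? pos q a) (discordant? p q a b)
  where
  distinct : ∀ r → pos r b < pos r a → a ≢ b
  distinct r lt refl = <-irrefl refl lt

∣pos-pos∣≤discordances : ∀ {n} (p q : Permutation′ n) a → ∣ pos p a - pos q a ∣ ≤ discordances p q a
∣pos-pos∣≤discordances {n} p q a = begin
  ∣ pos p a - pos q a ∣
    ≡⟨ cong₂ ∣_-_∣ (pos≡∑-𝟙-below p a) (pos≡∑-𝟙-below q a) ⟩
  ∣ ∑[ b < n ] 𝟙 (pos p b <? pos p a) - ∑[ b < n ] 𝟙 (pos q b <? pos q a) ∣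
    ≤⟨ ∣∑-∑∣≤∑∣-∣ (λ b → 𝟙 (pos p b <? pos p a)) (λ b → 𝟙 (pos q b <? pos q a)) ⟩
  ∑[ b < n ] ∣ 𝟙 (pos p b <? pos p a) - 𝟙 (pos q b <? pos q a) ∣
    ≤⟨ ∑-mono-≤ (∣𝟙-below-𝟙-below∣≤𝟙-discordant p q a) ⟩
  discordances p q a ∎
  where open ≤-Reasoning

inversions≡∑∑-𝟙-swapped : ∀ {n} (p q : Permutation′ n) →
  inversions p q ≡ ∑[ a < n ] ∑[ b < n ] 𝟙 (swapped? p q a b)
inversions≡∑∑-𝟙-swapped {n} p q =
  trans (sum-map-allFin (λ a → length (filter (swapped? p q a) (allFin n))))
        (sum-cong-≗ {n} (λ a → trans (length-filter≡sum-𝟙 (swapped? p q a) (allFin n))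
                                     (sum-map-allFin (𝟙 ∘ swapped? p q a))))

∑-discordances≤2*inversions : ∀ {n} (p q : Permutation′ n) →
  ∑[ a < n ] discordances p q a ≤ 2 * inversions p q
∑-discordances≤2*inversions {n} p q = begin
  ∑[ a < n ] ∑[ b < n ] 𝟙 (discordant? p q a b)
    ≤⟨ ∑-mono-≤ (λ a → ∑-mono-≤ (λ b → 𝟙-≤-⊎ id (discordant? p q a b) (swapped? p q a b) (swapped? p q b a))) ⟩
  ∑[ a < n ] ∑[ b < n ] (S a b + S b a)
    ≡⟨ sum-cong-≗ {n} (λ a → ∑-distrib-+ (λ b → S a b) (λ b → S b a)) ⟩
  ∑[ a < n ] (∑[ b < n ] S a b + ∑[ b < n ] S b a)
    ≡⟨ ∑-distrib-+ (λ a → ∑[ b < n ] S a b) (λ a → ∑[ b < n ] S b a) ⟩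
  I + ∑[ a < n ] ∑[ b < n ] S b a
    ≡⟨ cong (I +_) (∑-comm (λ a b → S b a)) ⟩
  I + I
    ≡⟨ cong (I +_) (+-identityʳ I) ⟨
  2 * I
    ≡⟨ cong (2 *_) (inversions≡∑∑-𝟙-swapped p q) ⟨
  2 * inversions p q ∎
  where
  open ≤-Reasoning
  S : Fin _ → Fin _ → ℕ
  S a b = 𝟙 (swapped? p q a b)
  I : ℕ
  I = ∑[ a < n ] ∑[ b < n ] S a b

module _ {n : ℕ} (ord : ℕ → Permutation′ n) where

  crossingsOf : Fin n → ℕ → ℕ
  crossingsOf a zero    = 0
  crossingsOf a (suc T) = crossingsOf a T + discordances (ord T) (ord (suc T)) a

  ∣pos-pos∣≤crossingsOf : ∀ a τ → ∣ pos (ord 0) a - pos (ord τ) a ∣ ≤ crossingsOf a τ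
  ∣pos-pos∣≤crossingsOf a zero    = ≤-reflexive (∣n-n∣≡0 (pos (ord 0) a))
  ∣pos-pos∣≤crossingsOf a (suc τ) =
    ≤-trans (∣-∣-triangle (pos (ord 0) a) (pos (ord τ) a) (pos (ord (suc τ)) a))
            (+-mono-≤ (∣pos-pos∣≤crossingsOf a τ) (∣pos-pos∣≤discordances (ord τ) (ord (suc τ)) a))

  crossingsOf-mono : ∀ a {τ T} → τ ≤′ T → crossingsOf a τ ≤ crossingsOf a T
  crossingsOf-mono a ≤′-refl       = ≤-refl
  crossingsOf-mono a (≤′-step τ≤T) = ≤-trans (crossingsOf-mono a τ≤T) (m≤m+n _ _)

  ∑-crossingsOf≤2*crossingsUpTo : ∀ T → ∑[ a < n ] crossingsOf a T ≤ 2 * crossingsUpTo ord T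
  ∑-crossingsOf≤2*crossingsUpTo zero    = ≤-reflexive (sum-replicate-zero n)
  ∑-crossingsOf≤2*crossingsUpTo (suc T) = begin
    ∑[ a < n ] (crossingsOf a T + discordances (ord T) (ord (suc T)) a)
      ≡⟨ ∑-distrib-+ (λ a → crossingsOf a T) (discordances (ord T) (ord (suc T))) ⟩
    ∑[ a < n ] crossingsOf a T + ∑[ a < n ] discordances (ord T) (ord (suc T)) a
      ≤⟨ +-mono-≤ (∑-crossingsOf≤2*crossingsUpTo T) (∑-discordances≤2*inversions (ord T) (ord (suc T))) ⟩
    2 * crossingsUpTo ord T + 2 * inversions (ord T) (ord (suc T))
      ≡⟨ *-distribˡ-+ 2 (crossingsUpTo ord T) (inversions (ord T) (ord (suc T))) ⟨
    2 * crossingsUpTo ord (suc T) ∎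
    where open ≤-Reasoning

  adjacent⇒∣pos-pos∣≤1+crossingsOf : ∀ a b {τ T} → τ ≤ T → ∣ pos (ord τ) a - pos (ord τ) b ∣ ≡ 1 →
    ∣ pos (ord 0) a - pos (ord 0) b ∣ ≤ 1 + (crossingsOf a T + crossingsOf b T)
  adjacent⇒∣pos-pos∣≤1+crossingsOf a b {τ} {T} τ≤T adjacent = begin
    ∣ a₀ - b₀ ∣                               ≤⟨ ∣-∣-triangle a₀ aτ b₀ ⟩
    ∣ a₀ - aτ ∣ + ∣ aτ - b₀ ∣                 ≤⟨ +-monoʳ-≤ ∣ a₀ - aτ ∣ (∣-∣-triangle aτ bτ b₀) ⟩
    ∣ a₀ - aτ ∣ + (∣ aτ - bτ ∣ + ∣ bτ - b₀ ∣) ≡⟨ x∙yz≈y∙xz ∣ a₀ - aτ ∣ ∣ aτ - bτ ∣ ∣ bτ - b₀ ∣ ⟩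
    ∣ aτ - bτ ∣ + (∣ a₀ - aτ ∣ + ∣ bτ - b₀ ∣) ≡⟨ cong₂ (λ x y → x + (∣ a₀ - aτ ∣ + y)) adjacent (∣-∣-comm bτ b₀) ⟩
    1 + (∣ a₀ - aτ ∣ + ∣ b₀ - bτ ∣)           ≤⟨ +-monoʳ-≤ 1 (+-mono-≤ (displacement a) (displacement b)) ⟩
    1 + (crossingsOf a T + crossingsOf b T)   ∎
    where
    open ≤-Reasoning
    a₀ aτ b₀ bτ : ℕ
    a₀ = pos (ord 0) a
    aτ = pos (ord τ) a
    b₀ = pos (ord 0) b
    bτ = pos (ord τ) b
    displacement : ∀ c → ∣ pos (ord 0) c - pos (ord τ) c ∣ ≤ crossingsOf c T
    displacement c = ≤-trans (∣pos-pos∣≤crossingsOf c τ) (crossingsOf-mono c (≤⇒≤′ τ≤T))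

sum-map-≤-length+ : ∀ {A : Set} {f g : A → ℕ} {xs : List A} → All (λ x → f x ≤ 1 + g x) xs →
                    sum (map f xs) ≤ length xs + sum (map g xs)
sum-map-≤-length+ []                            = z≤n
sum-map-≤-length+ {g = g} {x ∷ xs} (fx≤ ∷ f≤) =
  ≤-trans (+-mono-≤ fx≤ (sum-map-≤-length+ f≤))
          (≤-reflexive (cong suc (x∙yz≈y∙xz (g x) (length xs) (sum (map g xs)))))

degree-∷ : ∀ {n} (e : Event n) es a → degree (e ∷ es) a ≡ 𝟙 (a ∈ₑ? e) + degree es a
degree-∷ e es a = trans (length-filter≡sum-𝟙 (a ∈ₑ?_) (e ∷ es))
                        (cong (𝟙 (a ∈ₑ? e) +_) (sym (length-filter≡sum-𝟙 (a ∈ₑ?_) es)))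

degree≤maxDegree : ∀ {n} (es : List (Event n)) a → degree es a ≤ maxDegree es
degree≤maxDegree {n} es a =
  subst (degree es a ≤_) (cong (foldr _⊔_ 0) (sym (map-tabulate id (degree es)))) (≤-foldr-⊔ (degree es) a)
  where
  ≤-foldr-⊔ : ∀ {n} (f : Fin n → ℕ) i → f i ≤ foldr _⊔_ 0 (tabulate f)
  ≤-foldr-⊔ f Fin.zero    = m≤m⊔n _ _
  ≤-foldr-⊔ f (Fin.suc i) = ≤-trans (≤-foldr-⊔ (f ∘ Fin.suc) i) (m≤n⊔m _ _)

sum-endpoints≤∑-degree* : ∀ {n} (F : Fin n → ℕ) (es : List (Event n)) → All (λ e → u e ≢ v e) es →
  sum (map (λ e → F (u e) + F (v e)) es) ≤ ∑[ a < n ] (degree es a * F a)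
sum-endpoints≤∑-degree* F []       []          = z≤n
sum-endpoints≤∑-degree* {n} F (e ∷ es) (u≢v ∷ ne) = begin
  F (u e) + F (v e) + sum (map (λ e → F (u e) + F (v e)) es)
    ≤⟨ +-mono-≤ endpoints (sum-endpoints≤∑-degree* F es ne) ⟩
  ∑[ a < n ] (𝟙 (a ∈ₑ? e) * F a) + ∑[ a < n ] (degree es a * F a)
    ≡⟨ ∑-distrib-+ (λ a → 𝟙 (a ∈ₑ? e) * F a) (λ a → degree es a * F a) ⟨
  ∑[ a < n ] (𝟙 (a ∈ₑ? e) * F a + degree es a * F a)
    ≡⟨ sum-cong-≗ {n} (λ a → trans (cong (_* F a) (degree-∷ e es a))
                                   (*-distribʳ-+ (F a) (𝟙 (a ∈ₑ? e)) (degree es a))) ⟨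
  ∑[ a < n ] (degree (e ∷ es) a * F a) ∎
  where
  open ≤-Reasoning
  weight : ∀ {c} → c ∈ₑ e → 𝟙 (c ∈ₑ? e) * F c ≡ F c
  weight {c} c∈e = trans (cong (_* F c) (𝟙-yes c∈e (c ∈ₑ? e))) (+-identityʳ (F c))
  endpoints : F (u e) + F (v e) ≤ ∑[ a < n ] (𝟙 (a ∈ₑ? e) * F a)
  endpoints = subst₂ (λ x y → x + y ≤ ∑[ a < n ] (𝟙 (a ∈ₑ? e) * F a)) (weight (inj₁ refl)) (weight (inj₂ refl))
                     (∑-≥-pair (λ a → 𝟙 (a ∈ₑ? e) * F a) (u e) (v e) u≢v)

orderingCost-initialOrder≤ : ∀ {n} {es : List (Event n)} → All (λ e → (u e ≢ v e) × (s e ≤ t e)) es →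
  (V : Visualization es) → orderingCost es (order V 0) ≤ length es + maxDegree es * (2 * crossings V)
orderingCost-initialOrder≤ {n} {es} wf V = begin
  orderingCost es (order V 0)
    ≤⟨ sum-map-≤-length+ {g = λ e → F (u e) + F (v e)}
         (All.zipWith event-bound (All.zip (wf , afterAll V) , grouped V)) ⟩
  m + sum (map (λ e → F (u e) + F (v e)) es)
    ≤⟨ +-monoʳ-≤ m (sum-endpoints≤∑-degree* F es (All.map proj₁ wf)) ⟩
  m + ∑[ a < n ] (degree es a * F a)
    ≤⟨ +-monoʳ-≤ m (∑-mono-≤ (λ a → *-monoˡ-≤ (F a) (degree≤maxDegree es a))) ⟩
  m + ∑[ a < n ] (Δ * F a)
    ≡⟨ cong (m +_) (*-distribˡ-sum Δ F) ⟨
  m + Δ * ∑[ a < n ] F a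
    ≤⟨ +-monoʳ-≤ m (*-monoʳ-≤ Δ (∑-crossingsOf≤2*crossingsUpTo (order V) (horizon V))) ⟩
  m + Δ * (2 * crossings V) ∎
  where
  open ≤-Reasoning
  m Δ : ℕ
  m = length es
  Δ = maxDegree es
  F : Fin n → ℕ
  F a = crossingsOf (order V) a (horizon V)
  event-bound : ∀ {e} → ((u e ≢ v e × s e ≤ t e) × t e ≤ horizon V) ×
                        (∀ τ → s e ≤ τ → τ ≤ t e → ∣ pos (order V τ) (u e) - pos (order V τ) (v e) ∣ ≡ 1) →
                ∣ pos (order V 0) (u e) - pos (order V 0) (v e) ∣ ≤ 1 + (F (u e) + F (v e))
  event-bound {e} (((_ , s≤t) , t≤H) , adjacent) =
    adjacent⇒∣pos-pos∣≤1+crossingsOf (order V) (u e) (v e) (≤-trans s≤t t≤H) (adjacent (s e) ≤-refl s≤t)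

theorem2 : ∃[ k ] (∀ (n : ℕ) (es : List (Event n)) → ValidStoryline es → PairwiseSingleMeeting es → 1 ≤ length es → (π : Permutation′ n) → OptimalOrdering es π → (V : Visualization es) → orderingCost es π ∸ length es ≤ k * (2 * maxDegree es * crossings V))
theorem2 = 1 , λ n es valid _ _ π optimal V →
  let open ≤-Reasoning
      m : ℕ
      m = length es
      Δ : ℕ
      Δ = maxDegree es
      C : ℕ
      C = crossings V
  in begin
  orderingCost es π ∸ m
    ≤⟨ ∸-monoˡ-≤ m (≤-trans (optimal (order V 0)) (orderingCost-initialOrder≤ (proj₁ valid) V)) ⟩
  m + Δ * (2 * C) ∸ m ≡⟨ m+n∸m≡n m (Δ * (2 * C)) ⟩
  Δ * (2 * C)         ≡⟨ *-assoc Δ 2 C ⟨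
  Δ * 2 * C           ≡⟨ cong (_* C) (*-comm Δ 2) ⟩
  2 * Δ * C           ≡⟨ *-identityˡ (2 * Δ * C) ⟨
  1 * (2 * Δ * C)     ∎
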